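{- Let $G(V,E)$ be a graph with $|V|=n$, and let $w$ be a permutational $1$-$11$-representation of $G$. Then $w$ does not contain a factor $XXX$ with $X\in V^{+}$ such that the length of $X$ is not a multiple of $n$.
   Context: For a word $w$ and letters $x,y$, $w_{\{x,y\}}$ denotes the word obtained from $w$ by deleting all letters other than $x$ and $y$. A word $w\in V^{+}$ is a $1$-$11$-representation of a graph $G(V,E)$ if for all distinct $x,y\in V$: $x,y$ are adjacent in $G$ iff $w_{\{x,y\}}$ contains at most one factor of the form $xx$ or $yy$ in total (equivalently, non-adjacent iff $w_{\{x,y\}}$ contains at least two occurrences of $xx$, or at least two of $yy$, or at least one of each). A $1$-$11$-representation is permutational if it is a concatenation of permutations of $V$ (words in which each vertex of $V$ occurs exactly once). A word $u$ contains $v$ as a factor if $u=xvy$ for possibly empty words $x,y$. -}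

module Defs where

open import Data.Nat using (ℕ; zero; suc; _+_; _≤_)
open import Data.Fin using (Fin; _≟_)
open import Data.List using (List; []; _∷_; _++_; filter; concat; allFin)
open import Data.List.Relation.Unary.All using (All)
open import Data.List.Relation.Binary.Permutation.Propositional using (_↭_)
open import Data.Product using (Σ; ∃; ∃-syntax; _×_)
open import Relation.Binary.PropositionalEquality using (_≡_; _≢_)
open import Relation.Nullary using (¬_; yes; no)
open import Relation.Nullary.Decidable using (_⊎-dec_)
open import Function.Bundles using (_⇔_)

record Graph (n : ℕ) : Set₁ where
  field
    Adj     : Fin n → Fin n → Set
    symm    : ∀ {x y} → Adj x y → Adj y x
    irrefl  : ∀ {x} → ¬ Adj x x

Word : ℕ → Set
Word n = List (Fin n)

restrict : ∀ {n} → Fin n → Fin n → Word n → Word n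
restrict x y = filter (λ z → (z ≟ x) ⊎-dec (z ≟ y))

-- Number of occurrences of the factor x x in a word (occurrences may overlap).
countXX : ∀ {n} → Fin n → Word n → ℕ
countXX x []                  = 0
countXX x (a ∷ [])            = 0
countXX x (a ∷ rest@(b ∷ _)) = isXX a b + countXX x rest
  where
  isXX : Fin _ → Fin _ → ℕ
  isXX a b with a ≟ x | b ≟ x
  ... | yes _ | yes _ = 1
  ... | _     | _     = 0

Is1-11-Rep : ∀ {n} → Graph n → Word n → Set
Is1-11-Rep {n} G w =
  w ≢ [] ×
  (∀ (x y : Fin n) → x ≢ y →
     (Graph.Adj G x y ⇔ (countXX x (restrict x y w) + countXX y (restrict x y w) ≤ 1)))

IsPermutationWord : ∀ {n} → Word n → Set
IsPermutationWord {n} p = p ↭ allFin n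

IsPermutational : ∀ {n} → Word n → Set
IsPermutational {n} w = ∃[ ps ] (All IsPermutationWord ps × w ≡ concat ps)

HasFactor : ∀ {n} → Word n → Word n → Set
HasFactor u v = ∃[ x ] ∃[ y ] (u ≡ x ++ v ++ y)

-- A factor of a concatenation of permutations is a tail of one permutation, followed by
-- complete permutations, followed by a head of another, so in it the numbers of occurrences
-- of two letters differ by at most 2. In a factor X X X these numbers are three times those of X, hence all letters
-- occur in X equally often, say c times, and |X| = c n.
module Submission where

open import Defs
open import Data.Nat using (ℕ; zero; suc; _+_; _*_; _≤_; z≤n; s≤s)
open import Data.Nat.Properties
  using ( +-0-commutativeMonoid; +-assoc; +-suc; +-identityʳ; *-comm; *-suc
        ; ≤-trans; ≤-antisym; m≤m+n; m≤n+m; m≤n⇒m≤1+n; m<1+n⇒m≤n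
        ; +-mono-≤; +-monoʳ-≤; *-cancelˡ-<; module ≤-Reasoning )
open import Data.Nat.Divisibility using (_∣_; divides)
open import Data.List using (List; []; _∷_; [_]; _++_; length; filter; concat; tabulate; allFin)
open import Data.List.Properties using (∷-injective; filter-++; length-++; ++-identityʳ)
open import Data.List.Relation.Unary.All using (All; []; _∷_)
open import Data.List.Relation.Binary.Permutation.Propositional using (_↭_)
open import Data.List.Relation.Binary.Permutation.Propositional.Properties using (↭-length; filter-↭)
open import Data.Fin using (Fin; zero; suc; _≟_)
open import Data.Product using (∃-syntax; _×_; _,_)
open import Data.Sum using (_⊎_; inj₁; inj₂)
open import Relation.Binary.PropositionalEquality
  using (_≡_; _≢_; refl; sym; trans; cong; cong₂; subst; subst₂; module ≡-Reasoning)
open import Relation.Nullary using (¬_; yes; no)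
open import Algebra.Properties.CommutativeMonoid.Sum +-0-commutativeMonoid
  using (sum-syntax; ∑-distrib-+; sum-cong-≗; sum-replicate-zero)

private
  variable
    n : ℕ
    A : Set

levi : (a b c d : List A) → a ++ b ≡ c ++ d →
       (∃[ e ] (c ≡ a ++ e × b ≡ e ++ d)) ⊎ (∃[ e ] (a ≡ c ++ e × d ≡ e ++ b))
levi []      b c       d eq = inj₁ (c , refl , eq)
levi (x ∷ a) b []      d eq = inj₂ (x ∷ a , refl , sym eq)
levi (x ∷ a) b (y ∷ c) d eq with ∷-injective eq
... | refl , eq′ with levi a b c d eq′
...   | inj₁ (e , c≡ae , b≡ed) = inj₁ (e , cong (x ∷_) c≡ae , b≡ed)
...   | inj₂ (e , a≡ce , d≡eb) = inj₂ (e , cong (x ∷_) a≡ce , d≡eb)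

count : Fin n → Word n → ℕ
count a w = length (filter (_≟ a) w)

count-++ : (a : Fin n) (u v : Word n) → count a (u ++ v) ≡ count a u + count a v
count-++ a u v = trans (cong length (filter-++ (_≟ a) u v)) (length-++ (filter (_≟ a) u))

count-∷ : (a x : Fin n) (w : Word n) → count a (x ∷ w) ≡ count a [ x ] + count a w
count-∷ a x w = count-++ a [ x ] w

count-↭ : (a : Fin n) {u v : Word n} → u ↭ v → count a u ≡ count a v
count-↭ a u↭v = ↭-length (filter-↭ (_≟ a) u↭v)

count-singleton-comm : (a x : Fin n) → count a [ x ] ≡ count x [ a ]
count-singleton-comm a x with x ≟ a | a ≟ x
... | yes _    | yes _    = refl
... | no _     | no _     = refl
... | yes refl | no a≢a   with () ← a≢a refl
... | no x≢x   | yes refl with () ← x≢x refl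

count-suc-suc : (a x : Fin n) → count (suc a) [ suc x ] ≡ count a [ x ]
count-suc-suc a x with x ≟ a
... | yes _ = refl
... | no _  = refl

∑-count-singleton : (x : Fin n) → ∑[ a < n ] count a [ x ] ≡ 1
∑-count-singleton {suc n} zero    = cong suc (sum-replicate-zero n)
∑-count-singleton {suc n} (suc x) =
  trans (sum-cong-≗ (λ a → count-suc-suc a x)) (∑-count-singleton x)

count-tabulate : (a : Fin n) {m : ℕ} (f : Fin m → Fin n) →
                 count a (tabulate f) ≡ ∑[ i < m ] count a [ f i ]
count-tabulate a {zero}  f = refl
count-tabulate a {suc m} f =
  trans (count-∷ a (f zero) _) (cong (count a [ f zero ] +_) (count-tabulate a (λ i → f (suc i))))

count-allFin : (a : Fin n) → count a (allFin n) ≡ 1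
count-allFin a = begin
  count a (allFin _)         ≡⟨ count-tabulate a (λ i → i) ⟩
  ∑[ i < _ ] count a [ i ]   ≡⟨ sum-cong-≗ (count-singleton-comm a) ⟩
  ∑[ i < _ ] count i [ a ]   ≡⟨ ∑-count-singleton a ⟩
  1                          ∎
  where open ≡-Reasoning

length≡∑count : (w : Word n) → length w ≡ ∑[ a < n ] count a w
length≡∑count {n} []      = sym (sum-replicate-zero n)
length≡∑count     (x ∷ w) = sym (begin
  ∑[ a < _ ] count a (x ∷ w)                            ≡⟨ sum-cong-≗ (λ a → count-∷ a x w) ⟩
  ∑[ a < _ ] (count a [ x ] + count a w)                ≡⟨ ∑-distrib-+ (λ a → count a [ x ]) (λ a → count a w) ⟩
  ∑[ a < _ ] count a [ x ] + ∑[ a < _ ] count a w       ≡⟨ cong₂ _+_ (∑-count-singleton x) (sym (length≡∑count w)) ⟩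
  suc (length w)                                        ∎)
  where open ≡-Reasoning

∑-const : ∀ m (c : ℕ) → ∑[ i < m ] c ≡ m * c
∑-const zero    c = refl
∑-const (suc m) c = cong (c +_) (∑-const m c)

equal-counts⇒∣length : (w : Word n) → (∀ a b → count a w ≡ count b w) → n ∣ length w
equal-counts⇒∣length {zero}  w _         = divides 0 (length≡∑count w)
equal-counts⇒∣length {suc n} w all-equal = divides (count zero w) (begin
  length w                            ≡⟨ length≡∑count w ⟩
  ∑[ a < suc n ] count a w            ≡⟨ sum-cong-≗ (λ a → all-equal a zero) ⟩
  ∑[ a < suc n ] count zero w         ≡⟨ ∑-const (suc n) (count zero w) ⟩
  suc n * count zero w                ≡⟨ *-comm (suc n) _ ⟩
  count zero w * suc n                ∎)
  where open ≡-Reasoning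

AtMostOnce : Word n → Set
AtMostOnce F = ∀ a → count a F ≤ 1

Balanced : ℕ → Word n → Set
Balanced k F = ∀ a b → count a F ≤ k + count b F

permutation-count : {p : Word n} → IsPermutationWord p → ∀ a → count a p ≡ 1
permutation-count p↭allFin a = trans (count-↭ a p↭allFin) (count-allFin a)

permutation-factor-atMostOnce : (u F v : Word n) → IsPermutationWord (u ++ F ++ v) → AtMostOnce F
permutation-factor-atMostOnce u F v perm a = begin
  count a F                            ≤⟨ m≤n+m (count a F) (count a u) ⟩
  count a u + count a F                ≤⟨ m≤m+n _ (count a v) ⟩
  count a u + count a F + count a v    ≡⟨ +-assoc (count a u) _ _ ⟩
  count a u + (count a F + count a v)  ≡⟨ cong (count a u +_) (count-++ a F v) ⟨
  count a u + count a (F ++ v)         ≡⟨ count-++ a u (F ++ v) ⟨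
  count a (u ++ F ++ v)                ≡⟨ permutation-count perm a ⟩
  1                                    ∎
  where open ≤-Reasoning

atMostOnce⇒balanced : {F : Word n} → AtMostOnce F → Balanced 1 F
atMostOnce⇒balanced once a b = ≤-trans (once a) (m≤m+n 1 _)

balanced-weaken : ∀ {k} {F : Word n} → Balanced k F → Balanced (suc k) F
balanced-weaken bal a b = m≤n⇒m≤1+n (bal a b)

balanced-++-atMostOnce : ∀ {k} {s t : Word n} → AtMostOnce s → Balanced k t → Balanced (suc k) (s ++ t)
balanced-++-atMostOnce {k = k} {s} {t} once bal a b = begin
  count a (s ++ t)                 ≡⟨ count-++ a s t ⟩
  count a s + count a t            ≤⟨ +-mono-≤ (once a) (bal a b) ⟩
  suc k + count b t                ≤⟨ +-monoʳ-≤ (suc k) (m≤n+m _ (count b s)) ⟩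
  suc k + (count b s + count b t)  ≡⟨ cong (suc k +_) (count-++ b s t) ⟨
  suc k + count b (s ++ t)         ∎
  where open ≤-Reasoning

balanced-++-permutation : ∀ {k} {p t : Word n} → IsPermutationWord p → Balanced k t → Balanced k (p ++ t)
balanced-++-permutation {k = k} {p} {t} perm bal a b = begin
  count a (p ++ t)             ≡⟨ count-++ a p t ⟩
  count a p + count a t        ≡⟨ cong (_+ count a t) (permutation-count perm a) ⟩
  suc (count a t)              ≤⟨ s≤s (bal a b) ⟩
  suc (k + count b t)          ≡⟨ +-suc k _ ⟨
  k + suc (count b t)          ≡⟨ cong (λ c → k + (c + count b t)) (permutation-count perm b) ⟨
  k + (count b p + count b t)  ≡⟨ cong (k +_) (count-++ b p t) ⟨
  k + count b (p ++ t)         ∎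
  where open ≤-Reasoning

prefix-balanced : {ps : List (Word n)} → All IsPermutationWord ps →
                  ∀ F v → concat ps ≡ F ++ v → Balanced 1 F
prefix-balanced [] [] v _ a b = z≤n
prefix-balanced {ps = p ∷ ps} (perm ∷ perms) F v eq with levi p (concat ps) F v eq
... | inj₁ (e , refl , concat≡ev) = balanced-++-permutation {k = 1} perm (prefix-balanced perms e v concat≡ev)
... | inj₂ (e , refl , _)         = atMostOnce⇒balanced {F = F} (permutation-factor-atMostOnce [] F e perm)

factor-balanced : {ps : List (Word n)} → All IsPermutationWord ps →
                  ∀ u F v → concat ps ≡ u ++ F ++ v → Balanced 2 F
factor-balanced [] [] [] v _ a b = z≤n
factor-balanced {ps = p ∷ ps} (perm ∷ perms) u F v eq with levi p (concat ps) u (F ++ v) eq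
... | inj₁ (e , refl , concat≡eFv) = factor-balanced perms e F v concat≡eFv
... | inj₂ (e , refl , Fv≡e-concat) with levi F v e (concat ps) Fv≡e-concat
...   | inj₁ (e′ , refl , _) =
        balanced-weaken {F = F} (atMostOnce⇒balanced {F = F} (permutation-factor-atMostOnce u F e′ perm))
...   | inj₂ (e′ , refl , concat≡e′v) =
        balanced-++-atMostOnce {k = 1} {s = e}
          (permutation-factor-atMostOnce u e [] (subst IsPermutationWord (cong (u ++_) (sym (++-identityʳ e))) perm))
          (prefix-balanced perms e′ v concat≡e′v)

count-cube : (a : Fin n) (X : Word n) → count a (X ++ X ++ X) ≡ 3 * count a X
count-cube a X = begin
  count a (X ++ X ++ X)                   ≡⟨ count-++ a X (X ++ X) ⟩
  count a X + count a (X ++ X)            ≡⟨ cong (count a X +_) (count-++ a X X) ⟩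
  count a X + (count a X + count a X)     ≡⟨ cong (λ c → count a X + (count a X + c)) (+-identityʳ _) ⟨
  3 * count a X                           ∎
  where open ≡-Reasoning

3*m≤2+3*n⇒m≤n : ∀ m n → 3 * m ≤ 2 + 3 * n → m ≤ n
3*m≤2+3*n⇒m≤n m n h = m<1+n⇒m≤n (*-cancelˡ-< 3 m (suc n) (subst (suc (3 * m) ≤_) (sym (*-suc 3 n)) (s≤s h)))

cube-balanced⇒equal-counts : (X : Word n) → Balanced 2 (X ++ X ++ X) → ∀ a b → count a X ≡ count b X
cube-balanced⇒equal-counts X bal a b = ≤-antisym (≤-count a b) (≤-count b a)
  where
  ≤-count : ∀ a b → count a X ≤ count b X
  ≤-count a b = 3*m≤2+3*n⇒m≤n _ _ (subst₂ (λ l r → l ≤ 2 + r) (count-cube a X) (count-cube b X) (bal a b))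

mainTheorem2 : (n : ℕ) (G : Graph n) (w : Word n) →
    Is1-11-Rep G w → IsPermutational w →
    (X : Word n) → X ≢ [] → ¬ (n ∣ length X) →
    ¬ HasFactor w (X ++ X ++ X)
mainTheorem2 n _ w _ (ps , perms , w≡concat) X _ n∤∣X∣ (u , v , w≡uXXXv) =
  n∤∣X∣ (equal-counts⇒∣length X (cube-balanced⇒equal-counts X
    (factor-balanced perms u (X ++ X ++ X) v (trans (sym w≡concat) w≡uXXXv))))
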